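{- Let $q=2^h$ be a power of $2$, $s$ a positive integer and $\beta$ an element of a field of characteristic $2$. Let \[ H(S,Y)=Y^2+S^{4(q^s-1)}Y^{2q^s}+\beta^2 S^{2(q^s-1)}+S^{q^s-1}Y+S^{3(q^s-1)}Y^{q^s}+\beta S^{2(q^s-1)}+S^{2(q^s-1)}Y+S^{2(q^s-1)}Y^{q^s}. \] Then $H(S,Y)=G(S,Y)\cdot G'(S,Y)$, where \[ G(S,Y)= S^{2(q^s-1)}Y^{q^s}+S^{q^s-1}(1+\beta+ \mathrm{Tr}_{q^s/2}(Y))+Y, \] \[ G'(S,Y)= S^{2(q^s-1)}Y^{q^s}+S^{q^s-1}(\beta + \mathrm{Tr}_{q^s/2}(Y))+Y. \]
   Context: Here $\mathrm{Tr}_{q^s/2}(Y)$ denotes the polynomial $\sum_{i=0}^{sh-1}Y^{2^i}$. -}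

module Defs where

open import Level using (Level)
open import Data.Nat as ℕ using (ℕ; zero; suc)
open import Algebra.Bundles using (CommutativeRing)

module Lemma3p10 {c ℓ : Level} (R : CommutativeRing c ℓ) where
  open CommutativeRing R
  open import Algebra.Properties.Semiring.Exp semiring using (_^_)

  CharTwo : Set ℓ
  CharTwo = 1# + 1# ≈ 0#

  trSum : ℕ → Carrier → Carrier
  trSum zero    Y = 0#
  trSum (suc n) Y = trSum n Y + Y ^ (2 ℕ.^ n)

  Q : ℕ → ℕ → ℕ
  Q h s = (2 ℕ.^ h) ℕ.^ s

  -- Tr_{q^s/2}(Y) = Σ_{i=0}^{s h - 1} Y^(2^i)
  Tr : ℕ → ℕ → Carrier → Carrier
  Tr h s Y = trSum (s ℕ.* h) Y

  H : ℕ → ℕ → Carrier → Carrier → Carrier → Carrier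
  H h s β S Y =
    Y ^ 2 + S ^ (4 ℕ.* (Q h s ℕ.∸ 1)) * Y ^ (2 ℕ.* Q h s)
    + β ^ 2 * S ^ (2 ℕ.* (Q h s ℕ.∸ 1))
    + S ^ (Q h s ℕ.∸ 1) * Y
    + S ^ (3 ℕ.* (Q h s ℕ.∸ 1)) * Y ^ Q h s
    + β * S ^ (2 ℕ.* (Q h s ℕ.∸ 1))
    + S ^ (2 ℕ.* (Q h s ℕ.∸ 1)) * Y
    + S ^ (2 ℕ.* (Q h s ℕ.∸ 1)) * Y ^ Q h s

  G : ℕ → ℕ → Carrier → Carrier → Carrier → Carrier
  G h s β S Y =
    S ^ (2 ℕ.* (Q h s ℕ.∸ 1)) * Y ^ Q h s
    + S ^ (Q h s ℕ.∸ 1) * (1# + β + Tr h s Y)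
    + Y

  G′ : ℕ → ℕ → Carrier → Carrier → Carrier → Carrier
  G′ h s β S Y =
    S ^ (2 ℕ.* (Q h s ℕ.∸ 1)) * Y ^ Q h s
    + S ^ (Q h s ℕ.∸ 1) * (β + Tr h s Y)
    + Y

-- Write a = S^(q^s - 1), z = Y^(q^s), t = Tr(Y) and u = a²z + a(β + t) + Y, so that G = u + a
-- and G′ = u. In characteristic 2 squaring is additive, hence u² = a⁴z² + a²β² + a²t² + Y², and
-- G G′ = u² + a u differs from H only in having a²(t² + t) where H has a²(Y + z). These agree
-- because the Artin–Schreier map x ↦ x² + x is additive in characteristic 2 and telescopes
-- along the trace sum: Tr(Y)² + Tr(Y) = Y + Y^(q^s).
module Submission where

open import Defs
open import Level using (Level)
open import Data.Nat using (ℕ; _≤_)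
open import Algebra.Bundles using (Semiring; CommutativeRing)
import Data.Nat as ℕ
import Data.Nat.Properties as ℕ
open import Relation.Binary.PropositionalEquality as ≡ using (_≡_)
import Relation.Binary.Reasoning.Setoid as SetoidReasoning
import Algebra.Properties.Semiring.Exp as Exp
import Algebra.Properties.CommutativeSemigroup as CommutativeSemigroupProperties
import Algebra.Solver.Ring.NaturalCoefficients.Default as RingSolver

module SemiringPowers {a ℓ : Level} (R : Semiring a ℓ) where
  open Semiring R
  open Exp R

  ^-1* : ∀ x n → x ^ (1 ℕ.* n) ≈ x ^ n
  ^-1* x n = ^-congʳ x (ℕ.+-identityʳ n)

  ^-2* : ∀ x n → x ^ (2 ℕ.* n) ≈ x ^ n * x ^ n
  ^-2* x n = trans (^-homo-* x n (1 ℕ.* n)) (*-congˡ (^-1* x n))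

  ^-3* : ∀ x n → x ^ (3 ℕ.* n) ≈ x ^ n * (x ^ n * x ^ n)
  ^-3* x n = trans (^-homo-* x n (2 ℕ.* n)) (*-congˡ (^-2* x n))

  ^-4* : ∀ x n → x ^ (4 ℕ.* n) ≈ x ^ n * (x ^ n * (x ^ n * x ^ n))
  ^-4* x n = trans (^-homo-* x n (3 ℕ.* n)) (*-congˡ (^-3* x n))

  x^2≈x*x : ∀ x → x ^ 2 ≈ x * x
  x^2≈x*x x = *-congˡ (*-identityʳ x)

module Factorisation {c ℓ : Level} (R : CommutativeRing c ℓ) where
  open CommutativeRing R
  open Lemma3p10 R
  open Exp semiring using (_^_; ^-congʳ)
  open SemiringPowers semiring
  open CommutativeSemigroupProperties +-commutativeSemigroup using (interchange)
  open SetoidReasoning setoid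
  open RingSolver commutativeSemiring using (solve; _:=_; _:+_; _:*_; con)

  2^[s*h]≡Q : ∀ h s → 2 ℕ.^ (s ℕ.* h) ≡ Q h s
  2^[s*h]≡Q h s = ≡.trans (≡.cong (2 ℕ.^_) (ℕ.*-comm s h)) (≡.sym (ℕ.^-*-assoc 2 h s))

  ℘ : Carrier → Carrier
  ℘ x = x * x + x

  -- H, G and G′ with S^(q^s - 1) replaced by a and Y^(q^s) by z.
  H₀ : (a z β Y : Carrier) → Carrier
  H₀ a z β Y =
    Y * Y + a * (a * (a * a)) * (z * z) + β * β * (a * a) + a * Y
    + a * (a * a) * z + β * (a * a) + a * a * Y + a * a * z

  G₀ G′₀ : (a z β t Y : Carrier) → Carrier
  G₀  a z β t Y = a * a * z + a * (1# + β + t) + Y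
  G′₀ a z β t Y = a * a * z + a * (β + t) + Y

  module CharacteristicTwo (char2 : CharTwo) where

    x+x≈0 : ∀ x → x + x ≈ 0#
    x+x≈0 x = begin
      x + x               ≈⟨ +-cong (*-identityˡ x) (*-identityˡ x) ⟨
      1# * x + 1# * x     ≈⟨ distribʳ x 1# 1# ⟨
      (1# + 1#) * x       ≈⟨ *-congʳ char2 ⟩
      0# * x              ≈⟨ zeroˡ x ⟩
      0#                  ∎

    +-cancel-twice : ∀ x y w → (x + w) + (y + w) ≈ x + y
    +-cancel-twice x y w = begin
      (x + w) + (y + w)   ≈⟨ interchange x w y w ⟩
      (x + y) + (w + w)   ≈⟨ +-congˡ (x+x≈0 w) ⟩
      (x + y) + 0#        ≈⟨ +-identityʳ (x + y) ⟩
      x + y               ∎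

    square-+ : ∀ x y → (x + y) * (x + y) ≈ x * x + y * y
    square-+ x y = begin
      (x + y) * (x + y)                  ≈⟨ expand x y ⟩
      (x * x + x * y) + (y * y + x * y)  ≈⟨ +-cancel-twice (x * x) (y * y) (x * y) ⟩
      x * x + y * y                      ∎
      where
      expand : ∀ x y → (x + y) * (x + y) ≈ (x * x + x * y) + (y * y + x * y)
      expand = solve 2 (λ x y → (x :+ y) :* (x :+ y) := ((x :* x :+ x :* y) :+ (y :* y :+ x :* y))) refl

    square-+₄ : ∀ x y z w →
      (x + y + z + w) * (x + y + z + w) ≈ x * x + y * y + z * z + w * w
    square-+₄ x y z w = begin
      (x + y + z + w) * (x + y + z + w)  ≈⟨ square-+ (x + y + z) w ⟩
      (x + y + z) * (x + y + z) + w * w  ≈⟨ +-congʳ (square-+ (x + y) z) ⟩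
      (x + y) * (x + y) + z * z + w * w  ≈⟨ +-congʳ (+-congʳ (square-+ x y)) ⟩
      x * x + y * y + z * z + w * w      ∎

    ℘-+ : ∀ x y → ℘ (x + y) ≈ ℘ x + ℘ y
    ℘-+ x y = begin
      (x + y) * (x + y) + (x + y)  ≈⟨ +-congʳ (square-+ x y) ⟩
      (x * x + y * y) + (x + y)    ≈⟨ interchange (x * x) (y * y) x y ⟩
      (x * x + x) + (y * y + y)    ∎

    ℘-trSum : ∀ n Y → ℘ (trSum n Y) ≈ Y + Y ^ (2 ℕ.^ n)
    ℘-trSum ℕ.zero Y = begin
      0# * 0# + 0#  ≈⟨ +-identityʳ (0# * 0#) ⟩
      0# * 0#       ≈⟨ zeroˡ 0# ⟩
      0#            ≈⟨ x+x≈0 Y ⟨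
      Y + Y         ≈⟨ +-congˡ (*-identityʳ Y) ⟨
      Y + Y * 1#    ∎
    ℘-trSum (ℕ.suc n) Y = begin
      ℘ (t + w)                  ≈⟨ ℘-+ t w ⟩
      ℘ t + (w * w + w)          ≈⟨ +-congʳ (℘-trSum n Y) ⟩
      (Y + w) + (w * w + w)      ≈⟨ +-cancel-twice Y (w * w) w ⟩
      Y + w * w                  ≈⟨ +-congˡ (^-2* Y (2 ℕ.^ n)) ⟨
      Y + Y ^ (2 ℕ.^ ℕ.suc n)    ∎
      where
      t = trSum n Y
      w = Y ^ (2 ℕ.^ n)

    ℘-Tr : ∀ h s Y → ℘ (Tr h s Y) ≈ Y + Y ^ Q h s
    ℘-Tr h s Y = trans (℘-trSum (s ℕ.* h) Y) (+-congˡ (^-congʳ Y (2^[s*h]≡Q h s)))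

    factorisation : ∀ a β {t Y z} → ℘ t ≈ Y + z →
      H₀ a z β Y ≈ G₀ a z β t Y * G′₀ a z β t Y
    factorisation a β {t} {Y} {z} ℘t≈Y+z = begin
      H₀ a z β Y                                        ≈⟨ +-assoc _ (a * a * Y) (a * a * z) ⟩
      rest + (a * a * Y + a * a * z)                    ≈⟨ +-congˡ (distribˡ (a * a) Y z) ⟨
      rest + a * a * (Y + z)                            ≈⟨ +-congˡ (*-congˡ ℘t≈Y+z) ⟨
      rest + a * a * ℘ t                                ≈⟨ regroup a z β t Y ⟩
      a * a * z * (a * a * z) + a * β * (a * β)
        + a * t * (a * t) + Y * Y + a * u               ≈⟨ +-congʳ (square-+₄ (a * a * z) (a * β) (a * t) Y) ⟨
      u * u + a * u                                     ≈⟨ collect a z β t Y ⟩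
      G₀ a z β t Y * G′₀ a z β t Y                      ∎
      where
      rest = Y * Y + a * (a * (a * a)) * (z * z) + β * β * (a * a) + a * Y
             + a * (a * a) * z + β * (a * a)
      u = a * a * z + a * β + a * t + Y

      regroup : ∀ a z β t Y →
        Y * Y + a * (a * (a * a)) * (z * z) + β * β * (a * a) + a * Y
          + a * (a * a) * z + β * (a * a) + a * a * (t * t + t)
        ≈ a * a * z * (a * a * z) + a * β * (a * β) + a * t * (a * t) + Y * Y
          + a * (a * a * z + a * β + a * t + Y)
      regroup = solve 5 (λ a z β t Y →
        Y :* Y :+ a :* (a :* (a :* a)) :* (z :* z) :+ β :* β :* (a :* a) :+ a :* Y
          :+ a :* (a :* a) :* z :+ β :* (a :* a) :+ a :* a :* (t :* t :+ t)
        := a :* a :* z :* (a :* a :* z) :+ a :* β :* (a :* β) :+ a :* t :* (a :* t) :+ Y :* Y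
          :+ a :* (a :* a :* z :+ a :* β :+ a :* t :+ Y)) refl

      collect : ∀ a z β t Y →
        (a * a * z + a * β + a * t + Y) * (a * a * z + a * β + a * t + Y)
          + a * (a * a * z + a * β + a * t + Y)
        ≈ G₀ a z β t Y * G′₀ a z β t Y
      collect = solve 5 (λ a z β t Y →
        (a :* a :* z :+ a :* β :+ a :* t :+ Y) :* (a :* a :* z :+ a :* β :+ a :* t :+ Y)
          :+ a :* (a :* a :* z :+ a :* β :+ a :* t :+ Y)
        := (a :* a :* z :+ a :* (con 1 :+ β :+ t) :+ Y) :* (a :* a :* z :+ a :* (β :+ t) :+ Y)) refl

  module _ (h s : ℕ) (β S Y : Carrier) where
    private
      n = Q h s ℕ.∸ 1

    H≈H₀ : H h s β S Y ≈ H₀ (S ^ n) (Y ^ Q h s) β Y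
    H≈H₀ =
      +-cong (+-cong (+-cong (+-cong (+-cong (+-cong (+-cong
        (x^2≈x*x Y)
        (*-cong (^-4* S n) (^-2* Y (Q h s))))
        (*-cong (x^2≈x*x β) (^-2* S n)))
        refl)
        (*-congʳ (^-3* S n)))
        (*-congˡ (^-2* S n)))
        (*-congʳ (^-2* S n)))
        (*-congʳ (^-2* S n))

    G≈G₀ : G h s β S Y ≈ G₀ (S ^ n) (Y ^ Q h s) β (Tr h s Y) Y
    G≈G₀ = +-congʳ (+-congʳ (*-congʳ (^-2* S n)))

    G′≈G′₀ : G′ h s β S Y ≈ G′₀ (S ^ n) (Y ^ Q h s) β (Tr h s Y) Y
    G′≈G′₀ = +-congʳ (+-congʳ (*-congʳ (^-2* S n)))

lemma3p10 : {c ℓ : Level} (R : CommutativeRing c ℓ) →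
    Lemma3p10.CharTwo R →
    (h s : ℕ) → 1 ≤ s →
    (β S Y : CommutativeRing.Carrier R) →
    CommutativeRing._≈_ R (Lemma3p10.H R h s β S Y)
    (CommutativeRing._*_ R (Lemma3p10.G R h s β S Y) (Lemma3p10.G′ R h s β S Y))
lemma3p10 R char2 h s _ β S Y = begin
  H h s β S Y                                         ≈⟨ H≈H₀ h s β S Y ⟩
  H₀ a z β Y                                          ≈⟨ factorisation a β (℘-Tr h s Y) ⟩
  G₀ a z β (Tr h s Y) Y * G′₀ a z β (Tr h s Y) Y      ≈⟨ *-cong (G≈G₀ h s β S Y) (G′≈G′₀ h s β S Y) ⟨
  G h s β S Y * G′ h s β S Y                          ∎
  where
  open CommutativeRing R
  open Lemma3p10 R
  open Exp semiring using (_^_)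
  open Factorisation R
  open CharacteristicTwo char2
  open SetoidReasoning setoid
  a = S ^ (Q h s ℕ.∸ 1)
  z = Y ^ Q h s
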